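{- Let $m$ and $n$ be integers with $m,n\ge 2$. Then the $m\times n$ Klein bottle grid graph $\mathcal{K}_{m,n}$ admits a $C_4$-face-magic Klein bottle labeling if and only if $n$ is even.
   Context: For integers $m,n\ge 2$, the $m\times n$ Klein bottle grid graph $\mathcal{K}_{m,n}$ has vertex set $\{(i,j):1\le i\le m,\ 1\le j\le n\}$ and edges $(i,j)(i,j+1)$ for $1\le i\le m$, $1\le j\le n-1$; $(i,n)(i,1)$ for $1\le i\le m$; $(i,j)(i+1,j)$ for $1\le i\le m-1$, $1\le j\le n$; and $(m,j)(1,n+1-j)$ for $1\le j\le n$. It is embedded in the Klein bottle in the natural way; its faces that are $4$-cycles are, with column indices taken modulo $n$, the vertex sets $\{(i,j),(i,j+1),(i+1,j),(i+1,j+1)\}$ for $1\le i\le m-1$, $1\le j\le n$, and $\{(m,j),(m,j+1),(1,n+1-j),(1,n-j)\}$ for $1\le j\le n$. A $C_4$-face-magic Klein bottle labeling of $\mathcal{K}_{m,n}$ is a bijection $f:V(\mathcal{K}_{m,n})\to\{1,2,\dots,mn\}$ (write $x_{i,j}=f(i,j)$) such that the sum of the labels of the four vertices of every such $4$-cycle face equals one common constant $S$ (the $C_4$-face-magic value). -}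

module Defs where

open import Data.Nat using (ℕ; zero; suc; _+_; _*_; _∸_; _<_; NonZero)
open import Data.Nat.DivMod using (_%_; m%n<n)
open import Data.Fin using (Fin; toℕ; fromℕ<)
open import Data.Product using (_×_; _,_; Σ)
open import Function.Bundles using (_⤖_; Bijection)

-- Vertices (i , j) of K_{m,n} are 0-indexed: paper's (i+1 , j+1).
-- A labeling is a bijection V(K_{m,n}) ≅ Fin (m*n); the label of v is toℕ (φ v) + 1,
-- so labels range over {1, …, m n} bijectively.

modF : (k : ℕ) .{{_ : NonZero k}} → ℕ → Fin k
modF k a = fromℕ< (m%n<n a k)

lab : (m n : ℕ) .{{_ : NonZero m}} .{{_ : NonZero n}} →
      ((Fin m × Fin n) ⤖ Fin (m * n)) → ℕ → ℕ → ℕ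
lab m n φ i j = suc (toℕ (Bijection.to φ (modF m i , modF n j)))

-- φ is a C4-face-magic Klein bottle labeling with magic value S:
--  * interior faces {(i,j),(i,j+1),(i+1,j),(i+1,j+1)}, 0 ≤ i < m-1, 0 ≤ j < n (columns mod n);
--  * twisted faces {(m-1,j),(m-1,j+1),(0,n-1-j),(0,n-2-j)}, 0 ≤ j < n (columns mod n;
--    0-indexed form of the paper's {(m,j),(m,j+1),(1,n+1-j),(1,n-j)}).
IsFaceMagicWith : (m n : ℕ) .{{_ : NonZero m}} .{{_ : NonZero n}} →
                  ((Fin m × Fin n) ⤖ Fin (m * n)) → ℕ → Set
IsFaceMagicWith m n φ S =
  (∀ i j → suc i < m → j < n →
     L i j + L i (suc j) + L (suc i) j + L (suc i) (suc j) ≡ S)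
  × (∀ j → j < n →
     L (m ∸ 1) j + L (m ∸ 1) (suc j) + L 0 ((n + n ∸ 1) ∸ j) + L 0 ((n + n ∸ 2) ∸ j) ≡ S)
  where
  open import Relation.Binary.PropositionalEquality using (_≡_)
  L = lab m n φ

HasFaceMagicKleinLabeling : (m n : ℕ) .{{_ : NonZero m}} .{{_ : NonZero n}} → Set
HasFaceMagicKleinLabeling m n =
  Σ ((Fin m × Fin n) ⤖ Fin (m * n)) λ φ → Σ ℕ λ S → IsFaceMagicWith m n φ S

module Submission where

-- If n is odd, the sums L(i,j) + L(i+1,j) of vertically adjacent labels satisfy
-- s(j) + s(j+1) = S around the odd cycle of columns, which forces s(j) = S/2 for every j; the
-- same holds for the pairs L(m,j) + L(1,n+1-j) meeting across the twisted edge. Comparing rows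
-- 1,2 with rows 2,3 (or, when m = 2, with such a twisted pair) produces two vertices with equal
-- labels.
--
-- If n = 2k, columns are paired so that in every row the two vertices of a pair carry
-- complementary labels v and mn + 1 - v with v ≤ mk: columns 2t-1 and 2t when m is even, columns
-- j and n+1-j when m is odd. The small labels v are laid out in boustrophedon order (every
-- other block of consecutive values reversed), and then every face sums to 2(mn + 1): either it
-- consists of two complementary pairs, or its two small and two large labels balance.

open import Defs
open import Data.Nat using (ℕ; zero; suc; pred; _+_; _*_; _∸_; _≤_; _<_; z≤n; s≤s; z<s; NonZero; >-nonZero⁻¹)
open import Data.Nat.Properties
open import Data.Nat.DivMod using (_%_; [m+n]%n≡m%n; m<n⇒m%n≡m)
open import Data.Nat.Divisibility using (_∣_; divides)
open import Data.Bool using (Bool; true; false; not; _xor_)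
open import Data.Bool.Properties using (not-involutive; xor-assoc; xor-same; xor-identityʳ)
open import Data.Empty using (⊥; ⊥-elim)
open import Data.Fin using (Fin; toℕ; fromℕ<; cast; opposite; _↑ʳ_; remQuot; combine)
open import Data.Fin.Patterns using (0F; 1F)
open import Data.Fin.Properties
  using (toℕ-fromℕ<; fromℕ<-cong; toℕ-injective; toℕ<n; toℕ-cast; cast-involutive; opposite-prop;
         opposite-involutive; toℕ-↑ˡ; toℕ-↑ʳ; +↔⊎; *↔×; 2↔Bool; toℕ-combine; remQuot-combine)
open import Data.Product using (_×_; _,_; ∃; proj₁; proj₂)
open import Data.Product.Properties using (,-injective)
open import Data.Product.Algebra using (×-cong; ×-comm)
open import Data.Sum using (_⊎_; inj₁; inj₂; [_,_]′)
open import Function.Bundles using (_⇔_; mk⇔; _↔_; _⤖_; Inverse; Bijection; mk↔ₛ′)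
open import Function.Construct.Composition using (_↔-∘_)
open import Function.Properties.Inverse using (↔⇒⤖; ↔-refl; ↔-sym)
open import Relation.Binary.Definitions using (tri<; tri≈; tri>)
open import Relation.Binary.PropositionalEquality
open import Algebra.Properties.CommutativeSemigroup +-commutativeSemigroup using (interchange; xy∙z≈xz∙y)

even-or-odd : ∀ n → (∃ λ k → n ≡ 2 * k) ⊎ (∃ λ k → n ≡ suc (2 * k))
even-or-odd zero = inj₁ (0 , refl)
even-or-odd (suc n) with even-or-odd n
... | inj₁ (k , refl) = inj₂ (k , refl)
... | inj₂ (k , refl) = inj₁ (suc k , sym (*-suc 2 k))

+-regroup : ∀ a b c d → a + b + c + d ≡ (a + c) + (b + d)
+-regroup a b c d = trans (+-assoc (a + b) c d) (interchange a b c d)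

+-swap-seconds : ∀ a b c d → (a + b) + (c + d) ≡ (a + d) + (c + b)
+-swap-seconds a b c d =
  trans (interchange a b c d) (trans (cong ((a + c) +_) (+-comm b d)) (sym (interchange a d c b)))

double-injective : ∀ {x y} → x + x ≡ y + y → x ≡ y
double-injective {x} {y} e = *-cancelˡ-≡ x y 2
  (trans (cong (x +_) (+-identityʳ x)) (trans e (sym (cong (y +_) (+-identityʳ y)))))

cancel-middle : ∀ {a b c} → a + b ≡ b + c → a ≡ c
cancel-middle {a} {b} {c} e = +-cancelʳ-≡ b a c (trans e (+-comm b c))

n+n∸1≡n∸1+n : ∀ n .{{_ : NonZero n}} → n + n ∸ 1 ≡ (n ∸ 1) + n
n+n∸1≡n∸1+n (suc n) = refl

mirror-involutive : ∀ {n j} → j < n → n ∸ suc (n ∸ suc j) ≡ j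
mirror-involutive {n} {j} j<n = trans (sym (pred[m∸n]≡m∸[1+n] n (n ∸ suc j))) (cong pred (m∸[m∸n]≡n j<n))

mirror-<-half : ∀ {k j} → k ≤ j → j < 2 * k → 2 * k ∸ suc j < k
mirror-<-half {k} {j} k≤j j<2k = subst (2 * k ∸ suc j <_) 2k∸k≡k (∸-monoʳ-< (s≤s k≤j) j<2k)
  where
  2k∸k≡k : 2 * k ∸ k ≡ k
  2k∸k≡k = trans (cong (λ z → k + z ∸ k) (+-identityʳ k)) (m+n∸m≡n k k)

mirror-step : ∀ {k j} → k ≤ j → suc j < 2 * k →
              ∃ λ c → suc c < k × j ≡ 2 * k ∸ suc (suc c) × suc j ≡ 2 * k ∸ suc c
mirror-step {k} {j} k≤j j+1<2k = 2 * k ∸ suc (suc j) , c+1<k , j≡ , sym (mirror-involutive j+1<2k)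
  where
  j<2k : j < 2 * k
  j<2k = <-trans (n<1+n j) j+1<2k
  c+1≡ : 2 * k ∸ suc j ≡ suc (2 * k ∸ suc (suc j))
  c+1≡ = +-∸-assoc 1 j+1<2k
  c+1<k : suc (2 * k ∸ suc (suc j)) < k
  c+1<k = subst (_< k) c+1≡ (mirror-<-half k≤j j<2k)
  j≡ : j ≡ 2 * k ∸ suc (suc (2 * k ∸ suc (suc j)))
  j≡ = trans (sym (mirror-involutive j<2k)) (cong (λ c → 2 * k ∸ suc c) c+1≡)

double-mul : ∀ m k → m * k + m * k ≡ m * (2 * k)
double-mul m k = begin
  m * k + m * k       ≡⟨ cong (m * k +_) (+-identityʳ (m * k)) ⟨
  2 * (m * k)         ≡⟨ *-assoc 2 m k ⟨
  (2 * m) * k         ≡⟨ cong (_* k) (*-comm 2 m) ⟩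
  (m * 2) * k         ≡⟨ *-assoc m 2 k ⟩
  m * (2 * k)         ∎
  where open ≡-Reasoning

double-split : ∀ {k t} → t < k → 2 * k ≡ 2 * (k ∸ suc t) + suc (suc (2 * t))
double-split {k} {t} t<k = begin
  2 * k                             ≡⟨ cong (2 *_) (m∸n+n≡m t<k) ⟨
  2 * ((k ∸ suc t) + suc t)         ≡⟨ *-distribˡ-+ 2 (k ∸ suc t) (suc t) ⟩
  2 * (k ∸ suc t) + 2 * suc t       ≡⟨ cong (2 * (k ∸ suc t) +_) (*-suc 2 t) ⟩
  2 * (k ∸ suc t) + suc (suc (2 * t)) ∎
  where open ≡-Reasoning

mirror-even : ∀ {k t} → t < k → 2 * k ∸ suc (2 * t) ≡ suc (2 * (k ∸ suc t))
mirror-even {k} {t} t<k = begin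
  2 * k ∸ suc (2 * t)                                   ≡⟨ cong (_∸ suc (2 * t)) (double-split t<k) ⟩
  (2 * (k ∸ suc t) + suc (suc (2 * t))) ∸ suc (2 * t)    ≡⟨ cong (_∸ suc (2 * t)) (+-suc _ (suc (2 * t))) ⟩
  (suc (2 * (k ∸ suc t)) + suc (2 * t)) ∸ suc (2 * t)    ≡⟨ m+n∸n≡m _ (suc (2 * t)) ⟩
  suc (2 * (k ∸ suc t))                                 ∎
  where open ≡-Reasoning

mirror-odd : ∀ {k t} → t < k → 2 * k ∸ suc (suc (2 * t)) ≡ 2 * (k ∸ suc t)
mirror-odd {k} {t} t<k = trans (cong (_∸ suc (suc (2 * t))) (double-split t<k)) (m+n∸n≡m _ (suc (suc (2 * t))))

block-< : ∀ {m k i t} → i < m → t < k → k * i + t < m * k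
block-< {m} {k} {i} {t} i<m t<k = begin-strict
  k * i + t   <⟨ +-monoʳ-< (k * i) t<k ⟩
  k * i + k   ≡⟨ +-comm (k * i) k ⟩
  k + k * i   ≡⟨ *-suc k i ⟨
  k * suc i   ≤⟨ *-monoʳ-≤ k i<m ⟩
  k * m       ≡⟨ *-comm k m ⟩
  m * k       ∎
  where open ≤-Reasoning

module _ {m n : ℕ} .{{_ : NonZero m}} .{{_ : NonZero n}} (φ : (Fin m × Fin n) ⤖ Fin (m * n)) where

  lab-cong : ∀ {i j i' j'} → i % m ≡ i' % m → j % n ≡ j' % n → lab m n φ i j ≡ lab m n φ i' j'
  lab-cong e e' = cong (λ v → suc (toℕ (Bijection.to φ v)))
    (cong₂ _,_ (fromℕ<-cong _ _ e _ _) (fromℕ<-cong _ _ e' _ _))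

  lab-periodic : ∀ i j → lab m n φ i (j + n) ≡ lab m n φ i j
  lab-periodic i j = lab-cong refl ([m+n]%n≡m%n j n)

  lab-injective : ∀ i j i' j' → lab m n φ i j ≡ lab m n φ i' j' → i % m ≡ i' % m × j % n ≡ j' % n
  lab-injective i j i' j' e with ,-injective (Bijection.injective φ (toℕ-injective (suc-injective e)))
  ... | ei , ej = toℕ-modF≡ ei , toℕ-modF≡ ej
    where
    toℕ-modF≡ : ∀ {k a b} .{{_ : NonZero k}} → modF k a ≡ modF k b → a % k ≡ b % k
    toℕ-modF≡ e = trans (sym (toℕ-fromℕ< _)) (trans (cong toℕ e) (toℕ-fromℕ< _))

toℕ-modF : ∀ {k i} .{{_ : NonZero k}} → i < k → toℕ (modF k i) ≡ i
toℕ-modF i<k = trans (toℕ-fromℕ< _) (m<n⇒m%n≡m i<k)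

odd-cycle-half : ∀ (s : ℕ → ℕ) {S} k → (∀ j → j < suc (2 * k) → s j + s (suc j) ≡ S) →
                 s (suc (2 * k)) ≡ s 0 → s 0 + s 0 ≡ S
odd-cycle-half s {S} k step closed = begin
  s 0 + s 0                   ≡⟨ cong₂ _+_ (sym (s-even k ≤-refl)) (sym closed) ⟩
  s (2 * k) + s (suc (2 * k)) ≡⟨ step (2 * k) ≤-refl ⟩
  S                           ∎
  where
  open ≡-Reasoning
  s-even : ∀ t → t ≤ k → s (2 * t) ≡ s 0
  s-even zero    _   = refl
  s-even (suc t) t<k = trans (cong s (*-suc 2 t)) (trans two-steps (s-even t (<⇒≤ t<k)))
    where
    two-steps : s (suc (suc (2 * t))) ≡ s (2 * t)
    two-steps = +-cancelˡ-≡ (s (suc (2 * t))) _ _ (begin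
      s (suc (2 * t)) + s (suc (suc (2 * t))) ≡⟨ step (suc (2 * t)) (s≤s (*-monoʳ-< 2 t<k)) ⟩
      S                                       ≡⟨ step (2 * t) (s≤s (*-monoʳ-≤ 2 (<⇒≤ t<k))) ⟨
      s (2 * t) + s (suc (2 * t))             ≡⟨ +-comm (s (2 * t)) _ ⟩
      s (suc (2 * t)) + s (2 * t)             ∎)

module OddWidth {m n : ℕ} .{{_ : NonZero m}} .{{_ : NonZero n}} (φ : (Fin m × Fin n) ⤖ Fin (m * n))
                {S : ℕ} (magic : IsFaceMagicWith m n φ S) {k : ℕ} (n≡ : n ≡ suc (2 * k)) where

  rowPair : ℕ → ℕ → ℕ
  rowPair i j = lab m n φ i j + lab m n φ (suc i) j

  twistPair : ℕ → ℕ
  twistPair j = lab m n φ (m ∸ 1) j + lab m n φ 0 ((n + n ∸ 1) ∸ j)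

  rowPair-half : ∀ i → suc i < m → rowPair i 0 + rowPair i 0 ≡ S
  rowPair-half i i+1<m = odd-cycle-half (rowPair i) k step closed
    where
    step : ∀ j → j < suc (2 * k) → rowPair i j + rowPair i (suc j) ≡ S
    step j j<n = trans (sym (+-regroup (lab m n φ i j) (lab m n φ i (suc j))
                                       (lab m n φ (suc i) j) (lab m n φ (suc i) (suc j))))
                       (proj₁ magic i j i+1<m (subst (j <_) (sym n≡) j<n))
    closed : rowPair i (suc (2 * k)) ≡ rowPair i 0
    closed = subst (λ c → rowPair i c ≡ rowPair i 0) n≡
      (cong₂ _+_ (lab-periodic φ i 0) (lab-periodic φ (suc i) 0))

  twistPair-half : twistPair 0 + twistPair 0 ≡ S
  twistPair-half = odd-cycle-half twistPair k step closed
    where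
    step : ∀ j → j < suc (2 * k) → twistPair j + twistPair (suc j) ≡ S
    step j j<n = begin
      twistPair j + twistPair (suc j)
        ≡⟨ cong (λ c → twistPair j + (lab m n φ (m ∸ 1) (suc j) + lab m n φ 0 c)) mirror-suc ⟩
      _ ≡⟨ +-regroup (lab m n φ (m ∸ 1) j) (lab m n φ (m ∸ 1) (suc j))
                     (lab m n φ 0 ((n + n ∸ 1) ∸ j)) (lab m n φ 0 ((n + n ∸ 2) ∸ j)) ⟨
      _ ≡⟨ proj₂ magic j (subst (j <_) (sym n≡) j<n) ⟩
      S ∎
      where
      open ≡-Reasoning
      mirror-suc : (n + n ∸ 1) ∸ suc j ≡ (n + n ∸ 2) ∸ j
      mirror-suc = trans (∸-+-assoc (n + n) 1 (suc j)) (sym (∸-+-assoc (n + n) 2 j))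
    last-column : lab m n φ 0 ((n + n ∸ 1) ∸ n) ≡ lab m n φ 0 (n + n ∸ 1)
    last-column = begin
      lab m n φ 0 ((n + n ∸ 1) ∸ n) ≡⟨ cong (λ c → lab m n φ 0 (c ∸ n)) (n+n∸1≡n∸1+n n) ⟩
      lab m n φ 0 ((n ∸ 1) + n ∸ n) ≡⟨ cong (lab m n φ 0) (m+n∸n≡m (n ∸ 1) n) ⟩
      lab m n φ 0 (n ∸ 1)           ≡⟨ lab-periodic φ 0 (n ∸ 1) ⟨
      lab m n φ 0 ((n ∸ 1) + n)     ≡⟨ cong (lab m n φ 0) (n+n∸1≡n∸1+n n) ⟨
      lab m n φ 0 (n + n ∸ 1)       ∎
      where open ≡-Reasoning
    closed : twistPair (suc (2 * k)) ≡ twistPair 0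
    closed = subst (λ c → twistPair c ≡ twistPair 0) n≡
      (cong₂ _+_ (lab-periodic φ (m ∸ 1) 0) last-column)

oddWidth-impossible : ∀ m n .{{_ : NonZero m}} .{{_ : NonZero n}} → 2 ≤ m → 2 ≤ n →
                      (φ : (Fin m × Fin n) ⤖ Fin (m * n)) {S : ℕ} → IsFaceMagicWith m n φ S →
                      ∀ {k} → n ≡ suc (2 * k) → ⊥
oddWidth-impossible (suc zero) n (s≤s ()) φ magic n≡
oddWidth-impossible (suc (suc zero)) n 2≤m 2≤n φ magic {k} n≡ =
  <⇒≢ (∸-monoˡ-≤ 1 2≤n) (sym (begin
    n ∸ 1               ≡⟨ m<n⇒m%n≡m (∸-monoʳ-< {n} {1} {0} z<s (≤-trans (s≤s z≤n) 2≤n)) ⟨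
    (n ∸ 1) % n         ≡⟨ [m+n]%n≡m%n (n ∸ 1) n ⟨
    ((n ∸ 1) + n) % n   ≡⟨ cong (_% n) (n+n∸1≡n∸1+n n) ⟨
    (n + n ∸ 1) % n     ≡⟨ proj₂ (lab-injective φ 0 0 0 (n + n ∸ 1) corner≡) ⟨
    0 % n               ≡⟨ m<n⇒m%n≡m (≤-trans (s≤s z≤n) 2≤n) ⟩
    0                   ∎))
  where
  open OddWidth φ magic {k} n≡
  open ≡-Reasoning
  corner≡ : lab 2 n φ 0 0 ≡ lab 2 n φ 0 (n + n ∸ 1)
  corner≡ = cancel-middle (double-injective (trans (rowPair-half 0 ≤-refl) (sym twistPair-half)))
oddWidth-impossible (suc (suc (suc m))) n 2≤m 2≤n φ magic {k} n≡ = 0≢2 (begin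
    0             ≡⟨ m<n⇒m%n≡m z<s ⟨
    0 % (3 + m)   ≡⟨ proj₁ (lab-injective φ 0 0 2 0 column≡) ⟩
    2 % (3 + m)   ≡⟨ m<n⇒m%n≡m (s≤s (s≤s (s≤s z≤n))) ⟩
    2             ∎)
  where
  open OddWidth φ magic {k} n≡
  open ≡-Reasoning
  0≢2 : 0 ≢ 2
  0≢2 ()
  column≡ : lab (3 + m) n φ 0 0 ≡ lab (3 + m) n φ 2 0
  column≡ = cancel-middle (double-injective
    (trans (rowPair-half 0 (s≤s (s≤s z≤n))) (sym (rowPair-half 1 (s≤s (s≤s (s≤s z≤n)))))))

faceMagic⇒even : ∀ m n .{{_ : NonZero m}} .{{_ : NonZero n}} → 2 ≤ m → 2 ≤ n →
                 HasFaceMagicKleinLabeling m n → 2 ∣ n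
faceMagic⇒even m n 2≤m 2≤n (φ , S , magic) with even-or-odd n
... | inj₁ (k , n≡2k) = divides k (trans n≡2k (*-comm 2 k))
... | inj₂ (k , n≡2k+1) = ⊥-elim (oddWidth-impossible m n 2≤m 2≤n φ magic {k} n≡2k+1)

data Adjacent (n : ℕ) : ℕ → ℕ → Set where
  step : ∀ {j} → suc j < n → Adjacent n j (suc j)
  wrap : ∀ {j} → suc j ≡ n → Adjacent n j 0

adjacent : ∀ {n j} → j < n → ∃ (Adjacent n j)
adjacent j<n with m≤n⇒m<n∨m≡n j<n
... | inj₁ j+1<n = _ , step j+1<n
... | inj₂ j+1≡n = _ , wrap j+1≡n

Adjacent-< : ∀ {n j j'} → Adjacent n j j' → j < n × j' < n
Adjacent-< (step j+1<n) = <-trans (n<1+n _) j+1<n , j+1<n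
Adjacent-< (wrap refl)  = n<1+n _ , z<s

Adjacent-double : ∀ {k j j'} → Adjacent (2 * k) j j' →
                  (∃ λ t → t < k × j ≡ 2 * t × j' ≡ suc (2 * t)) ⊎
                  (∃ λ t → ∃ λ t' → Adjacent k t t' × j ≡ suc (2 * t) × j' ≡ 2 * t')
Adjacent-double {k} {j} adj with even-or-odd j | adj
... | inj₁ (t , refl) | step 2t+1<2k = inj₁ (t , *-cancelˡ-< 2 t k (<-trans (n<1+n _) 2t+1<2k) , refl , refl)
... | inj₁ (t , refl) | wrap 2t+1≡2k = ⊥-elim (even≢odd k t (sym 2t+1≡2k))
... | inj₂ (t , refl) | step 2t+2<2k =
  inj₂ (t , suc t , step (*-cancelˡ-< 2 (suc t) k (subst (_< 2 * k) (sym (*-suc 2 t)) 2t+2<2k)) ,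
        refl , sym (*-suc 2 t))
... | inj₂ (t , refl) | wrap 2t+2≡2k =
  inj₂ (t , 0 , wrap (*-cancelˡ-≡ (suc t) k 2 (trans (*-suc 2 t) 2t+2≡2k)) , refl , refl)

module _ {m n : ℕ} .{{_ : NonZero m}} .{{_ : NonZero n}} (φ : (Fin m × Fin n) ⤖ Fin (m * n)) where

  lab-next : ∀ {j j'} → Adjacent n j j' → ∀ r → lab m n φ r (suc j) ≡ lab m n φ r j'
  lab-next (step _)    r = refl
  lab-next (wrap j+1≡n) r = trans (cong (lab m n φ r) j+1≡n) (lab-periodic φ r 0)

  lab-mirror : ∀ {j} → j < n → ∀ r → lab m n φ r ((n + n ∸ 1) ∸ j) ≡ lab m n φ r (n ∸ suc j)
  lab-mirror {j} j<n r = begin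
    lab m n φ r ((n + n ∸ 1) ∸ j) ≡⟨ cong (lab m n φ r) (∸-+-assoc (n + n) 1 j) ⟩
    lab m n φ r (n + n ∸ suc j)   ≡⟨ cong (lab m n φ r) (trans (+-∸-assoc n j<n) (+-comm n _)) ⟩
    lab m n φ r ((n ∸ suc j) + n) ≡⟨ lab-periodic φ r (n ∸ suc j) ⟩
    lab m n φ r (n ∸ suc j)       ∎
    where open ≡-Reasoning

  lab-mirror-next : ∀ {j j'} → Adjacent n j j' → ∀ r →
                    lab m n φ r ((n + n ∸ 2) ∸ j) ≡ lab m n φ r (n ∸ suc j')
  lab-mirror-next {j} (step j+1<n) r = begin
    lab m n φ r ((n + n ∸ 2) ∸ j)       ≡⟨ cong (lab m n φ r) (∸-+-assoc (n + n) 2 j) ⟩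
    lab m n φ r (n + n ∸ suc (suc j))   ≡⟨ cong (lab m n φ r) (trans (+-∸-assoc n j+1<n) (+-comm n _)) ⟩
    lab m n φ r ((n ∸ suc (suc j)) + n) ≡⟨ lab-periodic φ r _ ⟩
    lab m n φ r (n ∸ suc (suc j))       ∎
    where open ≡-Reasoning
  lab-mirror-next {j} (wrap refl) r = cong (lab m n φ r) (begin
    (suc j + suc j ∸ 2) ∸ j     ≡⟨ ∸-+-assoc (suc j + suc j) 2 j ⟩
    suc j + suc j ∸ suc (suc j) ≡⟨ cong (suc j + suc j ∸_) (+-comm 1 (suc j)) ⟩
    suc j + suc j ∸ (suc j + 1) ≡⟨ [m+n]∸[m+o]≡n∸o (suc j) (suc j) 1 ⟩
    suc j ∸ 1                   ∎)
    where open ≡-Reasoning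

  faceMagic-fromAdjacent : ∀ {S} →
    (∀ i {j j'} → suc i < m → Adjacent n j j' →
       lab m n φ i j + lab m n φ i j' + lab m n φ (suc i) j + lab m n φ (suc i) j' ≡ S) →
    (∀ {j j'} → Adjacent n j j' →
       lab m n φ (m ∸ 1) j + lab m n φ (m ∸ 1) j' + lab m n φ 0 (n ∸ suc j) + lab m n φ 0 (n ∸ suc j') ≡ S) →
    IsFaceMagicWith m n φ S
  faceMagic-fromAdjacent {S} interior twisted = interior′ , twisted′
    where
    interior′ : ∀ i j → suc i < m → j < n →
                lab m n φ i j + lab m n φ i (suc j) + lab m n φ (suc i) j + lab m n φ (suc i) (suc j) ≡ S
    interior′ i j i+1<m j<n with adjacent j<n
    ... | _ , adj = trans (cong₂ (λ x y → lab m n φ i j + x + lab m n φ (suc i) j + y)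
                                 (lab-next adj i) (lab-next adj (suc i)))
                          (interior i i+1<m adj)
    twisted′ : ∀ j → j < n →
               lab m n φ (m ∸ 1) j + lab m n φ (m ∸ 1) (suc j) +
               lab m n φ 0 ((n + n ∸ 1) ∸ j) + lab m n φ 0 ((n + n ∸ 2) ∸ j) ≡ S
    twisted′ j j<n with adjacent j<n
    ... | _ , adj =
      trans (cong₃ (lab-next adj (m ∸ 1)) (lab-mirror j<n 0) (lab-mirror-next adj 0)) (twisted adj)
      where
      cong₃ : ∀ {x x' y y' z z'} → x ≡ x' → y ≡ y' → z ≡ z' →
              lab m n φ (m ∸ 1) j + x + y + z ≡ lab m n φ (m ∸ 1) j + x' + y' + z'
      cong₃ refl refl refl = refl

label : ℕ → Bool → ℕ → ℕ
label N false v = suc v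
label N true  v = N ∸ v

label-complement : ∀ {N v} b → v ≤ N → label N b v + label N (not b) v ≡ suc N
label-complement false v≤N = cong suc (m+[n∸m]≡n v≤N)
label-complement {N} {v} true v≤N = trans (+-suc (N ∸ v) v) (cong suc (m∸n+n≡m v≤N))

label-balanced : ∀ {N x x' y y'} {b b'} → b' ≡ not b → x + x' ≡ y + y' →
                 x ≤ N → x' ≤ N → y ≤ N → y' ≤ N →
                 (label N b x + label N b x') + (label N b' y + label N b' y') ≡ suc N + suc N
label-balanced {N} {x} {x'} {y} {y'} {false} refl e _ _ y≤N y'≤N = begin
  (suc x + suc x') + (label N true y + label N true y')
    ≡⟨ cong (λ z → suc z + (label N true y + label N true y'))
            (trans (+-suc x x') (trans (cong suc e) (sym (+-suc y y')))) ⟩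
  (suc y + suc y') + (label N true y + label N true y')
    ≡⟨ interchange (suc y) (suc y') _ _ ⟩
  (suc y + label N true y) + (suc y' + label N true y')
    ≡⟨ cong₂ _+_ (label-complement false y≤N) (label-complement false y'≤N) ⟩
  suc N + suc N ∎
  where open ≡-Reasoning
label-balanced {N} {x} {x'} {y} {y'} {true} refl e x≤N x'≤N y≤N y'≤N =
  trans (+-comm (label N true x + label N true x') _)
        (label-balanced {b = false} refl (sym e) y≤N y'≤N x≤N x'≤N)

face-sum-complementary : ∀ {N a b c d v w β β' γ γ'} → β' ≡ not β → γ' ≡ not γ →
                         a ≡ label N β v → b ≡ label N β' v → c ≡ label N γ w → d ≡ label N γ' w →
                         v ≤ N → w ≤ N → a + b + c + d ≡ suc N + suc N
face-sum-complementary {a = a} {b} {c} {d} {β = β} {γ = γ} refl refl refl refl refl refl v≤N w≤N =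
  trans (+-assoc (a + b) c d) (cong₂ _+_ (label-complement β v≤N) (label-complement γ w≤N))

face-sum-rowwise : ∀ {N a b c d x x' y y' β β'} → β' ≡ not β →
                   a ≡ label N β x → b ≡ label N β x' → c ≡ label N β' y → d ≡ label N β' y' →
                   x + x' ≡ y + y' → x ≤ N → x' ≤ N → y ≤ N → y' ≤ N → a + b + c + d ≡ suc N + suc N
face-sum-rowwise {a = a} {b} {c} {d} β' refl refl refl refl e x≤N x'≤N y≤N y'≤N =
  trans (+-assoc (a + b) c d) (label-balanced β' e x≤N x'≤N y≤N y'≤N)

face-sum-columnwise : ∀ {N a b c d x x' y y' β β'} → β' ≡ not β →
                      a ≡ label N β x → c ≡ label N β x' → b ≡ label N β' y → d ≡ label N β' y' →
                      x + x' ≡ y + y' → x ≤ N → x' ≤ N → y ≤ N → y' ≤ N → a + b + c + d ≡ suc N + suc N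
face-sum-columnwise {a = a} {b} {c} {d} β' ea ec eb ed e x≤N x'≤N y≤N y'≤N =
  trans (cong (_+ d) (xy∙z≈xz∙y a b c)) (face-sum-rowwise β' ea ec eb ed e x≤N x'≤N y≤N y'≤N)

face-sum-diagonal : ∀ {N a b c d x x' y y' β β'} → β' ≡ not β →
                    a ≡ label N β x → d ≡ label N β x' → b ≡ label N β' y → c ≡ label N β' y' →
                    x + x' ≡ y + y' → x ≤ N → x' ≤ N → y ≤ N → y' ≤ N → a + b + c + d ≡ suc N + suc N
face-sum-diagonal {a = a} {b} {c} {d} β' ea ed eb ec e x≤N x'≤N y≤N y'≤N =
  trans (xy∙z≈xz∙y (a + b) c d) (face-sum-columnwise β' ea ed eb ec e x≤N x'≤N y≤N y'≤N)

odd : ℕ → Bool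
odd zero    = false
odd (suc n) = not (odd n)

odd-pred : ∀ m .{{_ : NonZero m}} → odd (m ∸ 1) ≡ not (odd m)
odd-pred (suc m) = sym (not-involutive (odd m))

reflect : Bool → ℕ → ℕ → ℕ
reflect false k t = t
reflect true  k t = k ∸ suc t

reflect-< : ∀ b {k t} → t < k → reflect b k t < k
reflect-< false t<k = t<k
reflect-< true  t<k = ∸-monoʳ-< z<s t<k

reflect-pair : ∀ b {k t} → t < k → suc (reflect b k t + reflect (not b) k t) ≡ k
reflect-pair false {k} {t} t<k =
  trans (cong suc (+-comm t (k ∸ suc t))) (trans (sym (+-suc _ t)) (m∸n+n≡m t<k))
reflect-pair true  t<k = trans (sym (+-suc _ _)) (m∸n+n≡m t<k)

zigzag : ℕ → ℕ → ℕ → ℕ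
zigzag k i t = k * i + reflect (odd i) k t

zigzag-< : ∀ {m k i t} → i < m → t < k → zigzag k i t < m * k
zigzag-< {i = i} i<m t<k = block-< i<m (reflect-< (odd i) t<k)

zigzag-pair : ∀ {k i t t'} → t < k → t' < k →
              zigzag k i t + zigzag k (suc i) t ≡ zigzag k i t' + zigzag k (suc i) t'
zigzag-pair {k} {i} {t} {t'} t<k t'<k = begin
  (k * i + reflect (odd i) k t) + (k * suc i + reflect (not (odd i)) k t)
    ≡⟨ interchange (k * i) _ (k * suc i) _ ⟩
  (k * i + k * suc i) + (reflect (odd i) k t + reflect (not (odd i)) k t)
    ≡⟨ cong ((k * i + k * suc i) +_)
            (suc-injective (trans (reflect-pair (odd i) t<k) (sym (reflect-pair (odd i) t'<k)))) ⟩
  (k * i + k * suc i) + (reflect (odd i) k t' + reflect (not (odd i)) k t')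
    ≡⟨ interchange (k * i) (k * suc i) _ _ ⟩
  (k * i + reflect (odd i) k t') + (k * suc i + reflect (not (odd i)) k t') ∎
  where open ≡-Reasoning

reflectFin : ∀ {k} → Bool → Fin k → Fin k
reflectFin false t = t
reflectFin true  t = opposite t

toℕ-reflectFin : ∀ {k} b (t : Fin k) → toℕ (reflectFin b t) ≡ reflect b k (toℕ t)
toℕ-reflectFin false t = refl
toℕ-reflectFin true  t = opposite-prop t

reflectFin-involutive : ∀ {k} b (t : Fin k) → reflectFin b (reflectFin b t) ≡ t
reflectFin-involutive false t = refl
reflectFin-involutive true  t = opposite-involutive t

xor-cancelʳ : ∀ b c → (b xor c) xor c ≡ b
xor-cancelʳ b c = trans (xor-assoc b c c) (trans (cong (b xor_) (xor-same c)) (xor-identityʳ b))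

involution⇒↔ : ∀ {a} {A : Set a} (f : A → A) → (∀ x → f (f x) ≡ x) → A ↔ A
involution⇒↔ f f∘f≡id = mk↔ₛ′ f f f∘f≡id f∘f≡id

cast-↔ : ∀ {m n} → m ≡ n → Fin m ↔ Fin n
cast-↔ eq = mk↔ₛ′ (cast eq) (cast (sym eq)) (cast-involutive eq (sym eq)) (cast-involutive (sym eq) eq)

Bool×↔⊎ : ∀ {a} {A : Set a} → (Bool × A) ↔ (A ⊎ A)
Bool×↔⊎ {A = A} = mk↔ₛ′ to [ (false ,_) , (true ,_) ]′
                          (λ { (inj₁ _) → refl ; (inj₂ _) → refl }) (λ { (false , _) → refl ; (true , _) → refl })
  where
  to : Bool × A → A ⊎ A
  to (false , x) = inj₁ x
  to (true  , x) = inj₂ x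

reflectHalf : ∀ {k} → (Bool × Fin k) ↔ (Bool × Fin k)
reflectHalf = involution⇒↔ (λ (b , t) → b , reflectFin b t)
                           (λ (b , t) → cong (b ,_) (reflectFin-involutive b t))

complementJoin : ∀ {M} → (Bool × Fin M) ↔ Fin (M + M)
complementJoin = ↔-sym +↔⊎ ↔-∘ (Bool×↔⊎ ↔-∘ reflectHalf)

suc-toℕ-complementJoin : ∀ {M} b (v : Fin M) →
                         suc (toℕ (Inverse.to complementJoin (b , v))) ≡ label (M + M) b (toℕ v)
suc-toℕ-complementJoin {M} false v = cong suc (toℕ-↑ˡ v M)
suc-toℕ-complementJoin {M} true  v = begin
  suc (toℕ (M ↑ʳ opposite v))     ≡⟨ cong suc (toℕ-↑ʳ M (opposite v)) ⟩
  suc (M + toℕ (opposite v))      ≡⟨ cong (λ w → suc (M + w)) (opposite-prop v) ⟩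
  suc (M + (M ∸ suc (toℕ v)))     ≡⟨ +-suc M _ ⟨
  M + suc (M ∸ suc (toℕ v))       ≡⟨ cong (M +_) (+-∸-assoc 1 (toℕ<n v)) ⟨
  M + (M ∸ toℕ v)                 ≡⟨ +-∸-assoc M (<⇒≤ (toℕ<n v)) ⟨
  M + M ∸ toℕ v                   ∎
  where open ≡-Reasoning

gather : ∀ {m k} → (Fin m × (Bool × Fin k)) ↔ (Bool × (Fin m × Fin k))
gather = mk↔ₛ′ (λ (a , b , t) → b , a , t) (λ (b , a , t) → a , b , t) (λ _ → refl) (λ _ → refl)

reflectRows : ∀ {m k} → (Fin m × Fin k) ↔ (Fin m × Fin k)
reflectRows = involution⇒↔ (λ (a , t) → a , reflectFin (odd (toℕ a)) t)
                           (λ (a , t) → cong (a ,_) (reflectFin-involutive (odd (toℕ a)) t))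

remQuot-toℕ : ∀ {a k} (x : Fin (a * k)) (i : Fin a) (j : Fin k) →
              toℕ x ≡ k * toℕ i + toℕ j → remQuot k x ≡ (i , j)
remQuot-toℕ x i j e =
  trans (cong (remQuot _) (toℕ-injective (trans e (sym (toℕ-combine i j))))) (remQuot-combine i j)

toℕ-zigzag : ∀ {m k} (a : Fin m) (t : Fin k) →
             toℕ (combine a (reflectFin (odd (toℕ a)) t)) ≡ zigzag k (toℕ a) (toℕ t)
toℕ-zigzag {k = k} a t = trans (toℕ-combine a _) (cong (k * toℕ a +_) (toℕ-reflectFin (odd (toℕ a)) t))

-- A vertex with flag b and small index v < M gets label v + 1 if b is false and the
-- complementary label mn - v if b is true.
module FlaggedLabeling {m n k M : ℕ} .{{_ : NonZero m}} .{{_ : NonZero n}}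
  (columns : Fin n ↔ (Bool × Fin k)) (rows : (Bool × (Fin m × Fin k)) ↔ (Bool × Fin M))
  (M+M≡mn : M + M ≡ m * n) where

  flagged : Fin m × Fin n → Bool × Fin M
  flagged (a , c) = Inverse.to rows (Inverse.to gather (a , Inverse.to columns c))

  labeling : (Fin m × Fin n) ⤖ Fin (m * n)
  labeling = ↔⇒⤖ (cast-↔ M+M≡mn ↔-∘ (complementJoin ↔-∘ (rows ↔-∘ (gather ↔-∘ ×-cong ↔-refl columns))))

  lab-labeling : ∀ {i j b v} → proj₁ (flagged (modF m i , modF n j)) ≡ b →
                 toℕ (proj₂ (flagged (modF m i , modF n j))) ≡ v → lab m n labeling i j ≡ label (m * n) b v
  lab-labeling {i} {j} refl refl with flagged (modF m i , modF n j)
  ... | b , v = begin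
    suc (toℕ (cast M+M≡mn (Inverse.to complementJoin (b , v)))) ≡⟨ cong suc (toℕ-cast M+M≡mn _) ⟩
    suc (toℕ (Inverse.to complementJoin (b , v)))               ≡⟨ suc-toℕ-complementJoin b v ⟩
    label (M + M) b (toℕ v)                                     ≡⟨ cong (λ N → label N b (toℕ v)) M+M≡mn ⟩
    label (m * n) b (toℕ v)                                     ∎
    where open ≡-Reasoning

module EvenHeight (m k : ℕ) .{{_ : NonZero m}} .{{_ : NonZero k}} (m-even : odd m ≡ false) where

  private
    instance
      2k≢0 : NonZero (2 * k)
      2k≢0 = m*n≢0 2 k
    N : ℕ
    N = m * (2 * k)

  columns : Fin (2 * k) ↔ (Bool × Fin k)
  columns = ×-cong 2↔Bool ↔-refl ↔-∘ (×-comm (Fin k) (Fin 2) ↔-∘ (*↔× ↔-∘ cast-↔ (*-comm 2 k)))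

  rows : (Bool × (Fin m × Fin k)) ↔ (Bool × Fin (m * k))
  rows = ×-cong ↔-refl (↔-sym *↔× ↔-∘ reflectRows)

  open FlaggedLabeling columns rows (double-mul m k)

  lab-block : ∀ {i t} → i < m → t < k → (b : Fin 2) →
              lab m (2 * k) labeling i (2 * t + toℕ b) ≡ label N (Inverse.to 2↔Bool b) (zigzag k i t)
  lab-block {i} {t} i<m t<k b =
    lab-labeling (cong proj₁ flagged≡) (trans (cong (λ w → toℕ (proj₂ w)) flagged≡) value≡)
    where
    open ≡-Reasoning
    column-< : 2 * t + toℕ b < 2 * k
    column-< = subst (2 * t + toℕ b <_) (*-comm k 2) (block-< t<k (toℕ<n b))
    column≡ : Inverse.to columns (modF (2 * k) (2 * t + toℕ b)) ≡ (Inverse.to 2↔Bool b , fromℕ< t<k)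
    column≡ = cong (λ (t' , b') → Inverse.to 2↔Bool b' , t') (remQuot-toℕ _ (fromℕ< t<k) b (begin
      toℕ (cast (*-comm 2 k) (modF (2 * k) (2 * t + toℕ b))) ≡⟨ toℕ-cast (*-comm 2 k) _ ⟩
      toℕ (modF (2 * k) (2 * t + toℕ b))                   ≡⟨ toℕ-modF column-< ⟩
      2 * t + toℕ b                                        ≡⟨ cong (λ t' → 2 * t' + toℕ b) (toℕ-fromℕ< t<k) ⟨
      2 * toℕ (fromℕ< t<k) + toℕ b                         ∎))
    flagged≡ : flagged (modF m i , modF (2 * k) (2 * t + toℕ b)) ≡
               (Inverse.to 2↔Bool b , combine (modF m i) (reflectFin (odd (toℕ (modF m i))) (fromℕ< t<k)))
    flagged≡ = cong (λ p → Inverse.to rows (Inverse.to gather (modF m i , p))) column≡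
    value≡ : toℕ (combine (modF m i) (reflectFin (odd (toℕ (modF m i))) (fromℕ< t<k))) ≡ zigzag k i t
    value≡ = trans (toℕ-zigzag (modF m i) (fromℕ< t<k)) (cong₂ (zigzag k) (toℕ-modF i<m) (toℕ-fromℕ< t<k))

  private
    L : ℕ → ℕ → ℕ
    L = lab m (2 * k) labeling

  lab-even : ∀ {i t} → i < m → t < k → L i (2 * t) ≡ label N false (zigzag k i t)
  lab-even {i} {t} i<m t<k = trans (cong (L i) (sym (+-identityʳ (2 * t)))) (lab-block i<m t<k 0F)

  lab-odd : ∀ {i t} → i < m → t < k → L i (suc (2 * t)) ≡ label N true (zigzag k i t)
  lab-odd {i} {t} i<m t<k = trans (cong (L i) (+-comm 1 (2 * t))) (lab-block i<m t<k 1F)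

  zigzag-≤ : ∀ {i t} → i < m → t < k → zigzag k i t ≤ N
  zigzag-≤ i<m t<k = <⇒≤ (<-≤-trans (zigzag-< i<m t<k) (*-monoʳ-≤ m (m≤n*m k 2)))

  last-row-odd : odd (m ∸ 1) ≡ true
  last-row-odd = trans (odd-pred m) (cong not m-even)

  zigzag-twist : ∀ {t t'} → t < k → t' < k →
                 zigzag k (m ∸ 1) t + zigzag k 0 (k ∸ suc t') ≡ zigzag k (m ∸ 1) t' + zigzag k 0 (k ∸ suc t)
  zigzag-twist {t} {t'} _ _ rewrite last-row-odd =
    +-swap-seconds (k * (m ∸ 1)) (k ∸ suc t) (k * 0) (k ∸ suc t')

  0<m : 0 < m
  0<m = >-nonZero⁻¹ m

  m-1<m : m ∸ 1 < m
  m-1<m = ∸-monoʳ-< z<s 0<m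

  interior : ∀ i {j j'} → suc i < m → Adjacent (2 * k) j j' →
             L i j + L i j' + L (suc i) j + L (suc i) j' ≡ suc N + suc N
  interior i i+1<m adj with Adjacent-double {k} adj
  ... | inj₁ (t , t<k , refl , refl) =
    face-sum-complementary refl refl (lab-even i<m t<k) (lab-odd i<m t<k) (lab-even i+1<m t<k) (lab-odd i+1<m t<k)
                           (zigzag-≤ i<m t<k) (zigzag-≤ i+1<m t<k)
    where
    i<m : i < m
    i<m = <-trans (n<1+n i) i+1<m
  ... | inj₂ (t , t' , adj′ , refl , refl) =
    face-sum-columnwise refl (lab-odd i<m t<k) (lab-odd i+1<m t<k) (lab-even i<m t'<k) (lab-even i+1<m t'<k)
                        (zigzag-pair {k} {i} t<k t'<k)
                        (zigzag-≤ i<m t<k) (zigzag-≤ i+1<m t<k) (zigzag-≤ i<m t'<k) (zigzag-≤ i+1<m t'<k)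
    where
    i<m : i < m
    i<m = <-trans (n<1+n i) i+1<m
    t<k : t < k
    t<k = proj₁ (Adjacent-< adj′)
    t'<k : t' < k
    t'<k = proj₂ (Adjacent-< adj′)

  twisted : ∀ {j j'} → Adjacent (2 * k) j j' →
            L (m ∸ 1) j + L (m ∸ 1) j' + L 0 (2 * k ∸ suc j) + L 0 (2 * k ∸ suc j') ≡ suc N + suc N
  twisted adj with Adjacent-double {k} adj
  ... | inj₁ (t , t<k , refl , refl) =
    face-sum-complementary refl refl (lab-even m-1<m t<k) (lab-odd m-1<m t<k)
      (trans (cong (L 0) (mirror-even {k} t<k)) (lab-odd 0<m u<k))
      (trans (cong (L 0) (mirror-odd {k} t<k)) (lab-even 0<m u<k))
      (zigzag-≤ m-1<m t<k) (zigzag-≤ 0<m u<k)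
    where
    u<k : k ∸ suc t < k
    u<k = ∸-monoʳ-< z<s t<k
  ... | inj₂ (t , t' , adj′ , refl , refl) =
    face-sum-diagonal refl (lab-odd m-1<m t<k) (trans (cong (L 0) (mirror-even {k} t'<k)) (lab-odd 0<m u'<k))
      (lab-even m-1<m t'<k) (trans (cong (L 0) (mirror-odd {k} t<k)) (lab-even 0<m u<k))
      (zigzag-twist t<k t'<k) (zigzag-≤ m-1<m t<k) (zigzag-≤ 0<m u'<k) (zigzag-≤ m-1<m t'<k) (zigzag-≤ 0<m u<k)
    where
    t<k : t < k
    t<k = proj₁ (Adjacent-< adj′)
    t'<k : t' < k
    t'<k = proj₂ (Adjacent-< adj′)
    u<k : k ∸ suc t < k
    u<k = ∸-monoʳ-< z<s t<k
    u'<k : k ∸ suc t' < k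
    u'<k = ∸-monoʳ-< z<s t'<k

  hasLabeling : HasFaceMagicKleinLabeling m (2 * k)
  hasLabeling = labeling , suc N + suc N , faceMagic-fromAdjacent labeling interior twisted

module MirrorPairedRows {k N : ℕ} .{{_ : NonZero k}} (P Q x y : ℕ → ℕ) {ρ σ : Bool} (σ≡ : σ ≡ not ρ)
  (P-left  : ∀ {c} → c < k → P c ≡ label N ρ (x c))
  (P-right : ∀ {c} → c < k → P (2 * k ∸ suc c) ≡ label N (not ρ) (x c))
  (Q-left  : ∀ {c} → c < k → Q c ≡ label N σ (y c))
  (Q-right : ∀ {c} → c < k → Q (2 * k ∸ suc c) ≡ label N (not σ) (y c))
  (x-≤ : ∀ {c} → c < k → x c ≤ N) (y-≤ : ∀ {c} → c < k → y c ≤ N)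
  (balanced : ∀ {c} → suc c < k → x c + x (suc c) ≡ y c + y (suc c)) where

  face-sum : ∀ {j j'} → Adjacent (2 * k) j j' → P j + P j' + Q j + Q j' ≡ suc N + suc N
  face-sum {j} (step j+1<2k) with <-cmp (suc j) k
  ... | tri< j+1<k _ _ =
    face-sum-rowwise σ≡ (P-left j<k) (P-left j+1<k) (Q-left j<k) (Q-left j+1<k) (balanced j+1<k)
                     (x-≤ j<k) (x-≤ j+1<k) (y-≤ j<k) (y-≤ j+1<k)
    where
    j<k : j < k
    j<k = <-trans (n<1+n j) j+1<k
  ... | tri≈ _ refl _ =
    face-sum-complementary {β = ρ} {γ = σ} refl refl (P-left ≤-refl) (trans (cong P middle) (P-right ≤-refl))
                           (Q-left ≤-refl) (trans (cong Q middle) (Q-right ≤-refl)) (x-≤ ≤-refl) (y-≤ ≤-refl)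
    where
    middle : suc j ≡ 2 * suc j ∸ suc j
    middle = sym (trans (cong (_∸ suc j) (cong (suc j +_) (+-identityʳ (suc j)))) (m+n∸m≡n (suc j) (suc j)))
  ... | tri> _ _ k<j+1 with mirror-step (≤-pred k<j+1) j+1<2k
  ...   | c , c+1<k , j≡ , j+1≡ =
    face-sum-rowwise (cong not σ≡)
      (trans (cong P j≡) (P-right c+1<k)) (trans (cong P j+1≡) (P-right c<k))
      (trans (cong Q j≡) (Q-right c+1<k)) (trans (cong Q j+1≡) (Q-right c<k))
      (trans (+-comm (x (suc c)) (x c)) (trans (balanced c+1<k) (+-comm (y c) (y (suc c)))))
      (x-≤ c+1<k) (x-≤ c<k) (y-≤ c+1<k) (y-≤ c<k)
    where
    c<k : c < k
    c<k = <-trans (n<1+n c) c+1<k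
  face-sum {j} (wrap j+1≡2k) =
    face-sum-complementary (sym (not-involutive ρ)) (sym (not-involutive σ))
      (trans (cong P last) (P-right 0<k)) (P-left 0<k) (trans (cong Q last) (Q-right 0<k)) (Q-left 0<k)
      (x-≤ 0<k) (y-≤ 0<k)
    where
    0<k : 0 < k
    0<k = >-nonZero⁻¹ k
    last : j ≡ 2 * k ∸ 1
    last = cong pred j+1≡2k

module OddHeight (m k : ℕ) .{{_ : NonZero m}} .{{_ : NonZero k}} (m-odd : odd m ≡ true) where

  private
    instance
      2k≢0 : NonZero (2 * k)
      2k≢0 = m*n≢0 2 k
    N : ℕ
    N = m * (2 * k)

  columns : Fin (2 * k) ↔ (Bool × Fin k)
  columns = reflectHalf ↔-∘ (×-cong 2↔Bool ↔-refl ↔-∘ *↔×)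

  flipByRow : (Bool × (Fin m × Fin k)) ↔ (Bool × (Fin m × Fin k))
  flipByRow = involution⇒↔ (λ (b , a , c) → b xor odd (toℕ a) , a , c)
                           (λ (b , a , c) → cong (_, a , c) (xor-cancelʳ b (odd (toℕ a))))

  rows : (Bool × (Fin m × Fin k)) ↔ (Bool × Fin (k * m))
  rows = ×-cong ↔-refl (↔-sym *↔× ↔-∘ (reflectRows ↔-∘ ×-comm (Fin m) (Fin k))) ↔-∘ flipByRow

  open FlaggedLabeling columns rows (trans (cong₂ _+_ (*-comm k m) (*-comm k m)) (double-mul m k))

  private
    L : ℕ → ℕ → ℕ
    L = lab m (2 * k) labeling

  lab-column : ∀ {i c x β} → i < m → (c<k : c < k) → Inverse.to columns (modF (2 * k) x) ≡ (β , fromℕ< c<k) →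
               L i x ≡ label N (β xor odd i) (zigzag m c i)
  lab-column {i} {c} {x} {β} i<m c<k column≡ =
    lab-labeling (trans (cong proj₁ flagged≡) (cong (λ a → β xor odd a) (toℕ-modF i<m)))
                 (trans (cong (λ w → toℕ (proj₂ w)) flagged≡) value≡)
    where
    flagged≡ : flagged (modF m i , modF (2 * k) x) ≡
               (β xor odd (toℕ (modF m i)) , combine (fromℕ< c<k) (reflectFin (odd (toℕ (fromℕ< c<k))) (modF m i)))
    flagged≡ = cong (λ p → Inverse.to rows (Inverse.to gather (modF m i , p))) column≡
    value≡ : toℕ (combine (fromℕ< c<k) (reflectFin (odd (toℕ (fromℕ< c<k))) (modF m i))) ≡ zigzag m c i
    value≡ = trans (toℕ-zigzag (fromℕ< c<k) (modF m i)) (cong₂ (zigzag m) (toℕ-fromℕ< c<k) (toℕ-modF i<m))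

  column-left : ∀ {c} (c<k : c < k) → Inverse.to columns (modF (2 * k) c) ≡ (false , fromℕ< c<k)
  column-left {c} c<k = cong (λ (b , t) → Inverse.to 2↔Bool b , reflectFin (Inverse.to 2↔Bool b) t)
    (remQuot-toℕ (modF (2 * k) c) 0F (fromℕ< c<k)
      (trans (toℕ-modF (<-≤-trans c<k (m≤n*m k 2))) (sym (cong₂ _+_ (*-zeroʳ k) (toℕ-fromℕ< c<k)))))

  column-right : ∀ {c} (c<k : c < k) → Inverse.to columns (modF (2 * k) (2 * k ∸ suc c)) ≡ (true , fromℕ< c<k)
  column-right {c} c<k = trans
    (cong (λ (b , t) → Inverse.to 2↔Bool b , reflectFin (Inverse.to 2↔Bool b) t)
      (remQuot-toℕ (modF (2 * k) (2 * k ∸ suc c)) 1F (opposite (fromℕ< c<k)) (begin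
        toℕ (modF (2 * k) (2 * k ∸ suc c))  ≡⟨ toℕ-modF (∸-monoʳ-< z<s (<-≤-trans c<k (m≤n*m k 2))) ⟩
        2 * k ∸ suc c                       ≡⟨ cong (λ z → k + z ∸ suc c) (+-identityʳ k) ⟩
        k + k ∸ suc c                       ≡⟨ +-∸-assoc k c<k ⟩
        k + (k ∸ suc c)                     ≡⟨ cong₂ _+_ (*-identityʳ k) (cong (λ z → k ∸ suc z) (toℕ-fromℕ< c<k)) ⟨
        k * 1 + (k ∸ suc (toℕ (fromℕ< c<k))) ≡⟨ cong (k * 1 +_) (opposite-prop (fromℕ< c<k)) ⟨
        k * 1 + toℕ (opposite (fromℕ< c<k)) ∎)))
    (cong (true ,_) (opposite-involutive (fromℕ< c<k)))
    where open ≡-Reasoning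

  lab-left : ∀ {i c} → i < m → c < k → L i c ≡ label N (odd i) (zigzag m c i)
  lab-left i<m c<k = lab-column i<m c<k (column-left c<k)

  lab-right : ∀ {i c} → i < m → c < k → L i (2 * k ∸ suc c) ≡ label N (not (odd i)) (zigzag m c i)
  lab-right i<m c<k = lab-column i<m c<k (column-right c<k)

  zigzag-≤ : ∀ {i c} → i < m → c < k → zigzag m c i ≤ N
  zigzag-≤ i<m c<k =
    <⇒≤ (<-≤-trans (zigzag-< c<k i<m) (≤-trans (≤-reflexive (*-comm k m)) (*-monoʳ-≤ m (m≤n*m k 2))))

  0<m : 0 < m
  0<m = >-nonZero⁻¹ m

  m-1<m : m ∸ 1 < m
  m-1<m = ∸-monoʳ-< z<s 0<m

  interior : ∀ i {j j'} → suc i < m → Adjacent (2 * k) j j' →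
             L i j + L i j' + L (suc i) j + L (suc i) j' ≡ suc N + suc N
  interior i i+1<m = face-sum
    where
    i<m : i < m
    i<m = <-trans (n<1+n i) i+1<m
    open MirrorPairedRows (L i) (L (suc i)) (λ c → zigzag m c i) (λ c → zigzag m c (suc i)) {odd i} refl
      (lab-left i<m) (lab-right i<m) (lab-left i+1<m) (lab-right i+1<m) (zigzag-≤ i<m) (zigzag-≤ i+1<m)
      (λ {c} _ → zigzag-pair {m} {c} i<m i+1<m)

  twisted : ∀ {j j'} → Adjacent (2 * k) j j' →
            L (m ∸ 1) j + L (m ∸ 1) j' + L 0 (2 * k ∸ suc j) + L 0 (2 * k ∸ suc j') ≡ suc N + suc N
  twisted = face-sum
    where
    last-row-even : not (odd (m ∸ 1)) ≡ true
    last-row-even = cong not (trans (odd-pred m) (cong not m-odd))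
    open MirrorPairedRows (L (m ∸ 1)) (λ j → L 0 (2 * k ∸ suc j)) (λ c → zigzag m c (m ∸ 1)) (λ c → zigzag m c 0)
      (sym last-row-even) (lab-left m-1<m) (lab-right m-1<m) (lab-right 0<m)
      (λ c<k → trans (cong (L 0) (mirror-involutive (<-≤-trans c<k (m≤n*m k 2)))) (lab-left 0<m c<k))
      (zigzag-≤ m-1<m) (zigzag-≤ 0<m) (λ {c} _ → zigzag-pair {m} {c} m-1<m 0<m)

  hasLabeling : HasFaceMagicKleinLabeling m (2 * k)
  hasLabeling = labeling , suc N + suc N , faceMagic-fromAdjacent labeling interior twisted

faceMagic-double : ∀ m n .{{_ : NonZero m}} .{{_ : NonZero n}} k .{{_ : NonZero k}} → n ≡ 2 * k →
                   HasFaceMagicKleinLabeling m n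
faceMagic-double m _ k refl with odd m in parity
... | false = EvenHeight.hasLabeling m k parity
... | true  = OddHeight.hasLabeling m k parity

even⇒faceMagic : ∀ m n .{{_ : NonZero m}} .{{_ : NonZero n}} → 2 ≤ n → 2 ∣ n → HasFaceMagicKleinLabeling m n
even⇒faceMagic m n 2≤n (divides zero    n≡0)     = ⊥-elim (<⇒≢ (≤-trans z<s 2≤n) (sym n≡0))
even⇒faceMagic m n 2≤n (divides (suc q) n≡q*2) = faceMagic-double m n (suc q) (trans n≡q*2 (*-comm (suc q) 2))

theorem3p7 : (m n : ℕ) .{{_ : NonZero m}} .{{_ : NonZero n}} → 2 ≤ m → 2 ≤ n →
    HasFaceMagicKleinLabeling m n ⇔ (2 ∣ n)
theorem3p7 m n 2≤m 2≤n = mk⇔ (faceMagic⇒even m n 2≤m 2≤n) (even⇒faceMagic m n 2≤n)
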